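{- Let $n\ge1$. For a type $C$ parking function $f=(f_1,\dots,f_n)$ define a vertically $\mathfrak H_n$-labelled path $\Psi(f)=(\pi,\sigma)$ as follows: for each $k\in\{0,1,\dots,n\}$ let $L_k=\{i: f_i=k\}\cup\{ -i: f_i=-k<0\}$ (a set of nonzero integers); the path $\pi\in\mathcal L_{n,n}$ is the unique path having exactly $|L_k|$ North steps with $x$-coordinate $k$ for each $k$, and the labels of the North steps with $x$-coordinate $k$, read from bottom to top, are the elements of $L_k$ in increasing order (this determines $\sigma$ by $\sigma_i=$ label of the $i$-th North step). Then $\Psi$ is a bijection from the set of type $C$ parking functions of length $n$ onto the set of vertically $\mathfrak H_n$-labelled lattice paths. Its inverse sends $(\pi,\sigma)$ to $g$ where, for each $i$ with the $i$-th North step having $x$-coordinate $j$, $g_{\sigma_i}=j$ if $\sigma_i>0$ and $g_{ -\sigma_i}=-j$ if $\sigma_i<0$.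
   Context: A type $C$ parking function of length $n$ is an integer vector $f=(f_1,\dots,f_n)$ with $-n\le f_i\le n$ for all $i$. $\mathcal L_{n,n}$ is the set of lattice paths from $(0,0)$ to $(n,n)$ with $n$ North steps $(0,1)$ and $n$ East steps $(1,0)$. An integer $i$ is a rise of a path if its $i$-th North step is immediately followed by a North step. $\mathfrak H_n$ is the group of signed permutations (bijections $\sigma$ of $\{\pm1,\dots,\pm n\}$ with $\sigma(-k)=-\sigma(k)$), $\sigma_i=\sigma(i)$. A vertically $\mathfrak H_n$-labelled path is a pair $(\pi,\sigma)$ with $\pi\in\mathcal L_{n,n}$ and $\sigma\in\mathfrak H_n$ such that $\sigma_i<\sigma_{i+1}$ whenever $i$ is a rise of $\pi$, and $\sigma_1>0$ if $\pi$ begins with a North step; $\sigma_i$ is regarded as the label of the $i$-th North step. -}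

module Defs where

open import Data.Nat as ℕ using (ℕ; zero; suc)
open import Data.Integer as ℤ using (ℤ; +_; -_; -[1+_]; ∣_∣)
import Data.Integer.Properties as ℤP
open import Data.Fin using (Fin; toℕ)
open import Data.Vec as Vec using (Vec; lookup; tabulate)
open import Data.List as List using (List; []; _∷_; _++_; length; replicate; concatMap; mapMaybe; upTo; allFin; zip)
open import Data.Maybe using (Maybe; just; nothing)
open import Data.Product using (_×_; _,_; ∃-syntax)
open import Data.Unit using (⊤)
open import Data.Bool using (Bool; true; false; if_then_else_)
open import Relation.Nullary using (¬_)
open import Relation.Nullary.Decidable using (⌊_⌋)
open import Relation.Binary.PropositionalEquality using (_≡_)
open import Data.List.Sort.MergeSort ℤP.≤-decTotalOrder using (mergeSort)
open import Data.List.Sort.Base using (SortingAlgorithm)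

sortℤ : List ℤ → List ℤ
sortℤ = SortingAlgorithm.sort mergeSort

-- Type C parking functions of length n: f ∈ ℤ^n with -n ≤ f_i ≤ n.
-- f_i (1-indexed) is  lookup f i  with i : Fin n (0-indexed).

IsTypeCPF : (n : ℕ) → Vec ℤ n → Set
IsTypeCPF n f = ∀ (i : Fin n) → (- (+ n) ℤ.≤ lookup f i) × (lookup f i ℤ.≤ + n)

data Step : Set where
  N E : Step

countN : List Step → ℕ
countN []       = 0
countN (N ∷ s)  = suc (countN s)
countN (E ∷ s)  = countN s

countE : List Step → ℕ
countE []       = 0
countE (N ∷ s)  = countE s
countE (E ∷ s)  = suc (countE s)

IsLatticePath : ℕ → List Step → Set
IsLatticePath n π = (countN π ≡ n) × (countE π ≡ n)

-- i (1-indexed) is a rise of π: the i-th North step is immediately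
-- followed by a North step, i.e. π = p ++ N ∷ N ∷ q with p containing
-- exactly i-1 North steps.
IsRise : List Step → ℕ → Set
IsRise π i = ∃[ p ] ∃[ q ] (π ≡ p ++ (N ∷ N ∷ q)) × (suc (countN p) ≡ i)

-- Signed permutations of [n], recorded by their values
-- σ = (σ_1, …, σ_n) (list, 1-indexed σ_i = lookup σ (i-1)).
-- σ ∈ 𝔥_n iff σ_i ≠ 0, |σ_i| ≤ n, and i ↦ |σ_i| is a bijection of [n]
-- (σ is then extended to ±[n] by σ(-k) = -σ(k)).

IsSignedPerm : ℕ → List ℤ → Set
IsSignedPerm n σ =
  (length σ ≡ n)
  × (∀ (i : Fin (length σ)) → ¬ (List.lookup σ i ≡ + 0))
  × (∀ (i : Fin (length σ)) → ∣ List.lookup σ i ∣ ℕ.≤ n)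
  × (∀ (i j : Fin (length σ)) → ∣ List.lookup σ i ∣ ≡ ∣ List.lookup σ j ∣ → i ≡ j)
  × (∀ (k : ℕ) → 1 ℕ.≤ k → k ℕ.≤ n → ∃[ i ] ∣ List.lookup σ i ∣ ≡ k)

FirstCond : List Step → List ℤ → Set
FirstCond (N ∷ _) (x ∷ _) = + 0 ℤ.< x
FirstCond _       _       = ⊤

IsVLabelledPath : ℕ → List Step × List ℤ → Set
IsVLabelledPath n (π , σ) =
  IsLatticePath n π
  × IsSignedPerm n σ
  × (∀ (i j : Fin (length σ)) → toℕ j ≡ suc (toℕ i) →
       IsRise π (suc (toℕ i)) → List.lookup σ i ℤ.< List.lookup σ j)
  × FirstCond π σ

-- the label contributed by index i (0-indexed, so the integer i+1)
-- to L_k:  i+1 if f_{i+1} = k,  -(i+1) if f_{i+1} = -k < 0.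
pick : {n : ℕ} → Vec ℤ n → ℕ → Fin n → Maybe ℤ
pick f k i =
  if ⌊ lookup f i ℤ.≟ + k ⌋ then just (+ suc (toℕ i))
  else (if ⌊ 0 ℕ.<? k ⌋ then
          (if ⌊ lookup f i ℤ.≟ - (+ k) ⌋ then just (-[1+ toℕ i ]) else nothing)
        else nothing)

L : {n : ℕ} → Vec ℤ n → ℕ → List ℤ
L {n} f k = sortℤ (mapMaybe (pick f k) (allFin n))

Ψpath : {n : ℕ} → Vec ℤ n → List Step
Ψpath {n} f = concatMap block (upTo (suc n))
  where
  block : ℕ → List Step
  block k = replicate (length (L f k)) N ++ (if ⌊ k ℕ.<? n ⌋ then E ∷ [] else [])

Ψlabels : {n : ℕ} → Vec ℤ n → List ℤ
Ψlabels {n} f = concatMap (L f) (upTo (suc n))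

Ψ : (n : ℕ) → Vec ℤ n → List Step × List ℤ
Ψ n f = Ψpath f , Ψlabels f

northXs : List Step → ℕ → List ℕ
northXs []      x = []
northXs (N ∷ s) x = x ∷ northXs s x
northXs (E ∷ s) x = northXs s (suc x)

-- value g_{m+1}: if some label σ_i = m+1 sits at x-coordinate j then j,
-- if σ_i = -(m+1) then -j (default 0, never used for labelled paths).
gval : ℕ → List (ℤ × ℕ) → ℤ
gval m []            = + 0
gval m ((ℓ , j) ∷ r) =
  if ⌊ ℓ ℤ.≟ + suc m ⌋ then + j
  else (if ⌊ ℓ ℤ.≟ -[1+ m ] ⌋ then - (+ j) else gval m r)

Ψinv : (n : ℕ) → List Step × List ℤ → Vec ℤ n
Ψinv n (π , σ) = tabulate (λ (m : Fin n) → gval (toℕ m) (zip σ (northXs π 0)))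

-- A vertically labelled path is the same thing as its sequence of columns: column k lists, bottom
-- to top, the labels of the North steps at x-coordinate k, and the rise condition says exactly
-- that every column is increasing (the first-step condition says column 0 is positive).  Ψ(f)
-- has the sorted sets L_k as its columns; these sets partition the signed indices sgn(f_i)·i, so
-- Ψ(f) carries a signed permutation, and Ψinv reads f_i back off the unique column containing ±i.
-- Conversely, for a labelled path (π, σ) with g = Ψinv(π, σ), the set L_k(g) is exactly the set
-- of labels in column k of π; two strictly increasing lists with the same elements coincide, so
-- Ψ(g) has the columns of π and hence equals (π, σ).
module Submission where

open import Defs
open import Data.Nat as ℕ using (ℕ; zero; suc; z≤n; s≤s; _≤_; _<_)
import Data.Nat.Properties as ℕP
open import Data.Integer as ℤ using (ℤ; +_; -[1+_]; -_; ∣_∣)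
import Data.Integer.Properties as ℤP
open import Data.Fin as F using (Fin; toℕ)
import Data.Fin.Properties as FP
open import Data.Vec as V using (Vec)
import Data.Vec.Properties as VP
open import Data.List as L
  using (List; []; _∷_; _++_; length; replicate; map; mapMaybe; zip; allFin; fromMaybe)
import Data.List.Properties as LP
open import Data.List.Membership.Propositional using (_∈_)
import Data.List.Membership.Propositional.Properties as MP
open import Data.List.Relation.Binary.Subset.Propositional using (_⊆_)
open import Data.List.Relation.Unary.Any as Any using (here; there)
import Data.List.Relation.Unary.Any.Properties as AnyP
open import Data.List.Relation.Unary.All as All using (All; []; _∷_)
open import Data.List.Relation.Unary.AllPairs using (AllPairs; []; _∷_)
open import Data.List.Relation.Unary.Linked using (Linked; []; [-]; _∷_)
open import Data.List.Relation.Unary.Linked.Properties using (Linked⇒All; Linked⇒AllPairs)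
open import Data.List.Relation.Unary.Unique.Propositional using (Unique)
import Data.List.Relation.Unary.Unique.Propositional.Properties as UniqueP
open import Data.List.Relation.Binary.Permutation.Propositional
  using (_↭_; ↭-refl; ↭-sym; ↭-reflexive; ↭⇒↭ₛ; module PermutationReasoning)
import Data.List.Relation.Binary.Permutation.Propositional.Properties as PermP
import Data.List.Relation.Binary.Permutation.Setoid.Properties as PermS
open import Data.List.Sort.MergeSort ℤP.≤-decTotalOrder using (mergeSort)
open import Data.List.Sort.Base using (module SortingAlgorithm)
open import Data.Product using (_×_; _,_; proj₁; proj₂; ∃-syntax)
open import Data.Empty using (⊥; ⊥-elim)
open import Data.Unit using (⊤; tt)
open import Data.Maybe using (Maybe; just; nothing)
import Data.Maybe.Properties as MaybeP
open import Data.Bool using (if_then_else_)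
open import Function using (_∘_; id)
open import Relation.Binary.PropositionalEquality
  using (_≡_; _≢_; refl; sym; trans; cong; cong₂; subst; subst₂; setoid; module ≡-Reasoning)
open import Relation.Nullary using (¬_; yes; no)
open import Relation.Nullary.Decidable using (⌊_⌋)

open SortingAlgorithm mergeSort using (sort-↭; sort-↗)

∈-mapMaybe⁻ : ∀ {A B : Set} (p : A → Maybe B) xs {z} → z ∈ mapMaybe p xs →
  ∃[ a ] a ∈ xs × p a ≡ just z
∈-mapMaybe⁻ p (a ∷ xs) z∈ with p a in eq
∈-mapMaybe⁻ p (a ∷ xs) (here refl) | just b = a , here refl , eq
∈-mapMaybe⁻ p (a ∷ xs) (there z∈)  | just b with ∈-mapMaybe⁻ p xs z∈
... | a′ , a′∈ , pa′ = a′ , there a′∈ , pa′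
∈-mapMaybe⁻ p (a ∷ xs) z∈          | nothing with ∈-mapMaybe⁻ p xs z∈
... | a′ , a′∈ , pa′ = a′ , there a′∈ , pa′

mapMaybe-∷ : ∀ {A B : Set} (p : A → Maybe B) a xs → mapMaybe p (a ∷ xs) ≡ fromMaybe (p a) ++ mapMaybe p xs
mapMaybe-∷ p a xs with p a
... | just b  = refl
... | nothing = refl

∈-mapMaybe⁺ : ∀ {A B : Set} (p : A → Maybe B) {xs a z} → a ∈ xs → p a ≡ just z → z ∈ mapMaybe p xs
∈-mapMaybe⁺ p {a ∷ xs} (here refl) pa rewrite mapMaybe-∷ p a xs | pa = here refl
∈-mapMaybe⁺ p {b ∷ xs} (there a∈)  pa rewrite mapMaybe-∷ p b xs =
  MP.∈-++⁺ʳ (fromMaybe (p b)) (∈-mapMaybe⁺ p a∈ pa)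

Unique-map-mapMaybe : ∀ {A B : Set} (p : A → Maybe B) (key : A → ℕ) (key′ : B → ℕ) →
  (∀ {a z} → p a ≡ just z → key′ z ≡ key a) →
  ∀ xs → Unique (map key xs) → Unique (map key′ (mapMaybe p xs))
Unique-map-mapMaybe p key key′ keys [] [] = []
Unique-map-mapMaybe p key key′ keys (a ∷ xs) (a∉ ∷ xs!) with p a in pa
... | nothing = Unique-map-mapMaybe p key key′ keys xs xs!
... | just z  = All.tabulate distinct ∷ Unique-map-mapMaybe p key key′ keys xs xs!
  where
  distinct : ∀ {w} → w ∈ map key′ (mapMaybe p xs) → key′ z ≢ w
  distinct w∈ z≡w with MP.∈-map⁻ key′ w∈
  ... | z′ , z′∈ , refl with ∈-mapMaybe⁻ p xs z′∈
  ... | a′ , a′∈ , pa′ =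
    All.lookup a∉ (MP.∈-map⁺ key a′∈) (trans (sym (keys pa)) (trans z≡w (keys pa′)))

Unique-map⇒lookup-injective : ∀ {A : Set} (key : A → ℕ) (xs : List A) → Unique (map key xs) →
  ∀ (i j : Fin (length xs)) → key (L.lookup xs i) ≡ key (L.lookup xs j) → i ≡ j
Unique-map⇒lookup-injective key (x ∷ xs) xs! F.zero F.zero e = refl
Unique-map⇒lookup-injective key (x ∷ xs) (x∉ ∷ xs!) F.zero (F.suc j) e =
  ⊥-elim (All.lookup x∉ (MP.∈-map⁺ key (MP.∈-lookup j)) e)
Unique-map⇒lookup-injective key (x ∷ xs) (x∉ ∷ xs!) (F.suc i) F.zero e =
  ⊥-elim (All.lookup x∉ (MP.∈-map⁺ key (MP.∈-lookup i)) (sym e))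
Unique-map⇒lookup-injective key (x ∷ xs) (x∉ ∷ xs!) (F.suc i) (F.suc j) e =
  cong F.suc (Unique-map⇒lookup-injective key xs xs! i j e)

∈⇒lookup : ∀ {A : Set} {xs : List A} {z} → z ∈ xs → ∃[ i ] L.lookup xs i ≡ z
∈⇒lookup z∈ = Any.index z∈ , sym (AnyP.lookup-index z∈)

lookup-injective⇒Unique-map : ∀ {A : Set} (key : A → ℕ) (xs : List A) →
  (∀ (i j : Fin (length xs)) → key (L.lookup xs i) ≡ key (L.lookup xs j) → i ≡ j) →
  Unique (map key xs)
lookup-injective⇒Unique-map key []       inj = []
lookup-injective⇒Unique-map key (x ∷ xs) inj =
  All.tabulate distinct ∷
  lookup-injective⇒Unique-map key xs (λ i j e → FP.suc-injective (inj (F.suc i) (F.suc j) e))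
  where
  distinct : ∀ {w} → w ∈ map key xs → key x ≢ w
  distinct w∈ e with MP.∈-map⁻ key w∈
  ... | z , z∈ , refl with ∈⇒lookup z∈
  ... | j , refl with inj F.zero (F.suc j) e
  ... | ()

Unique-resp-↭ : ∀ {xs ys : List ℕ} → xs ↭ ys → Unique xs → Unique ys
Unique-resp-↭ xs↭ys = PermS.Unique-resp-↭ (setoid ℕ) (↭⇒↭ₛ xs↭ys)

∈-zip⇒∈ˡ : ∀ {A B : Set} (xs : List A) (ys : List B) {a b} → (a , b) ∈ zip xs ys → a ∈ xs
∈-zip⇒∈ˡ (x ∷ xs) (y ∷ ys) (here refl) = here refl
∈-zip⇒∈ˡ (x ∷ xs) (y ∷ ys) (there ab∈) = there (∈-zip⇒∈ˡ xs ys ab∈)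

∈ˡ⇒∈-zip : ∀ {A B : Set} (xs : List A) (ys : List B) {a} → a ∈ xs → length xs ≤ length ys →
  ∃[ b ] (a , b) ∈ zip xs ys
∈ˡ⇒∈-zip (x ∷ xs) (y ∷ ys) (here refl) _         = y , here refl
∈ˡ⇒∈-zip (x ∷ xs) (y ∷ ys) (there a∈)  (s≤s len) with ∈ˡ⇒∈-zip xs ys a∈ len
... | b , ab∈ = b , there ab∈

All-zip-proj₂ : ∀ {A B : Set} {P : B → Set} (xs : List A) {ys : List B} → All P ys →
  All (P ∘ proj₂) (zip xs ys)
All-zip-proj₂ []       _          = []
All-zip-proj₂ (x ∷ xs) []         = []
All-zip-proj₂ (x ∷ xs) (py ∷ pys) = py ∷ All-zip-proj₂ xs pys

increasing-⊆-⊇⇒≡ : ∀ {xs ys : List ℤ} → Linked ℤ._<_ xs → Linked ℤ._<_ ys →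
  xs ⊆ ys → ys ⊆ xs → xs ≡ ys
increasing-⊆-⊇⇒≡ xs↗ ys↗ =
  go (Linked⇒AllPairs ℤP.<-trans xs↗) (Linked⇒AllPairs ℤP.<-trans ys↗)
  where
  ⊆-tail : ∀ {x} {us vs : List ℤ} → All (x ℤ.<_) us → x ∷ us ⊆ x ∷ vs → us ⊆ vs
  ⊆-tail x<us sub z∈ with sub (there z∈)
  ... | here refl = ⊥-elim (ℤP.<-irrefl refl (All.lookup x<us z∈))
  ... | there z∈′ = z∈′

  go : ∀ {xs ys : List ℤ} → AllPairs ℤ._<_ xs → AllPairs ℤ._<_ ys → xs ⊆ ys → ys ⊆ xs → xs ≡ ys
  go {[]}     {[]}     _ _ _ _ = refl
  go {[]}     {y ∷ ys} _ _ _ ys⊆xs with ys⊆xs (here refl)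
  ... | ()
  go {x ∷ xs} {[]}     _ _ xs⊆ys _ with xs⊆ys (here refl)
  ... | ()
  go {x ∷ xs} {y ∷ ys} (x< ∷ xs↗) (y< ∷ ys↗) xs⊆ys ys⊆xs with xs⊆ys (here refl) | ys⊆xs (here refl)
  ... | here refl | _         = cong (x ∷_) (go xs↗ ys↗ (⊆-tail x< xs⊆ys) (⊆-tail y< ys⊆xs))
  ... | there x∈ | here refl  = ⊥-elim (ℤP.<-irrefl refl (All.lookup y< x∈))
  ... | there x∈ | there y∈   = ⊥-elim (ℤP.<-asym (All.lookup y< x∈) (All.lookup x< y∈))

nondecreasing∧Unique-∣∣⇒increasing : ∀ {xs : List ℤ} → Linked ℤ._≤_ xs → Unique (map ∣_∣ xs) → Linked ℤ._<_ xs
nondecreasing∧Unique-∣∣⇒increasing []          _                = []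
nondecreasing∧Unique-∣∣⇒increasing [-]         _                = [-]
nondecreasing∧Unique-∣∣⇒increasing (x≤y ∷ xs↗) ((x∉ ∷ _) ∷ xs!) =
  ℤP.≤∧≢⇒< x≤y (λ x≡y → x∉ (cong ∣_∣ x≡y)) ∷ nondecreasing∧Unique-∣∣⇒increasing xs↗ xs!

-- Paths as sequences of columns

pathOfColumns : (ℕ → List ℤ) → ℕ → List Step
pathOfColumns C zero    = replicate (length (C 0)) N
pathOfColumns C (suc r) = replicate (length (C 0)) N ++ E ∷ pathOfColumns (C ∘ suc) r

labelsOfColumns : (ℕ → List ℤ) → ℕ → List ℤ
labelsOfColumns C zero    = C 0
labelsOfColumns C (suc r) = C 0 ++ labelsOfColumns (C ∘ suc) r

-- The labels of the North steps at x-coordinate k, when σ labels the North steps of π in order.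
column : List Step → List ℤ → ℕ → List ℤ
column []      σ       k       = []
column (N ∷ π) []      k       = []
column (N ∷ π) (x ∷ σ) zero    = x ∷ column π σ zero
column (N ∷ π) (x ∷ σ) (suc k) = column π σ (suc k)
column (E ∷ π) σ       zero    = []
column (E ∷ π) σ       (suc k) = column π σ k

pathOfColumns-column : ∀ π σ r → countE π ≡ r → countN π ≡ length σ →
  pathOfColumns (column π σ) r ≡ π
pathOfColumns-column []      σ       zero    _ _ = refl
pathOfColumns-column (N ∷ π) (x ∷ σ) zero    e c =
  cong (N ∷_) (pathOfColumns-column π σ zero e (ℕP.suc-injective c))
pathOfColumns-column (N ∷ π) (x ∷ σ) (suc r) e c =
  cong (N ∷_) (pathOfColumns-column π σ (suc r) e (ℕP.suc-injective c))
pathOfColumns-column (E ∷ π) σ       (suc r) e c =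
  cong (E ∷_) (pathOfColumns-column π σ r (ℕP.suc-injective e) c)

labelsOfColumns-column : ∀ π σ r → countE π ≡ r → countN π ≡ length σ →
  labelsOfColumns (column π σ) r ≡ σ
labelsOfColumns-column []      []      zero    _ _ = refl
labelsOfColumns-column (N ∷ π) (x ∷ σ) zero    e c =
  cong (x ∷_) (labelsOfColumns-column π σ zero e (ℕP.suc-injective c))
labelsOfColumns-column (N ∷ π) (x ∷ σ) (suc r) e c =
  cong (x ∷_) (labelsOfColumns-column π σ (suc r) e (ℕP.suc-injective c))
labelsOfColumns-column (E ∷ π) σ       (suc r) e c =
  labelsOfColumns-column π σ r (ℕP.suc-injective e) c

column-pathOfColumns : ∀ C r k → k ≤ r → column (pathOfColumns C r) (labelsOfColumns C r) k ≡ C k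
column-pathOfColumns C zero    zero    _         = column-block (C 0)
  where
  column-block : ∀ c → column (replicate (length c) N) c 0 ≡ c
  column-block []      = refl
  column-block (x ∷ c) = cong (x ∷_) (column-block c)
column-pathOfColumns C (suc r) zero    _         =
  trans (column-block-zero (C 0) _ _) (LP.++-identityʳ (C 0))
  where
  column-block-zero : ∀ c ρ σ → column (replicate (length c) N ++ E ∷ ρ) (c ++ σ) 0 ≡ c ++ []
  column-block-zero []      ρ σ = refl
  column-block-zero (x ∷ c) ρ σ = cong (x ∷_) (column-block-zero c ρ σ)
column-pathOfColumns C (suc r) (suc k) (s≤s k≤r) =
  trans (column-block-suc (C 0) _ _) (column-pathOfColumns (C ∘ suc) r k k≤r)
  where
  column-block-suc : ∀ c ρ σ → column (replicate (length c) N ++ ρ) (c ++ σ) (suc k) ≡ column ρ σ (suc k)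
  column-block-suc []      ρ σ = refl
  column-block-suc (x ∷ c) ρ σ = column-block-suc c ρ σ

pathOfColumns-cong : ∀ C D r → (∀ k → k ≤ r → C k ≡ D k) → pathOfColumns C r ≡ pathOfColumns D r
pathOfColumns-cong C D zero    C≗D = cong (λ c → replicate (length c) N) (C≗D 0 z≤n)
pathOfColumns-cong C D (suc r) C≗D = cong₂ (λ c ρ → replicate (length c) N ++ E ∷ ρ) (C≗D 0 z≤n)
  (pathOfColumns-cong (C ∘ suc) (D ∘ suc) r (λ k k≤r → C≗D (suc k) (s≤s k≤r)))

labelsOfColumns-cong : ∀ C D r → (∀ k → k ≤ r → C k ≡ D k) → labelsOfColumns C r ≡ labelsOfColumns D r
labelsOfColumns-cong C D zero    C≗D = C≗D 0 z≤n
labelsOfColumns-cong C D (suc r) C≗D = cong₂ _++_ (C≗D 0 z≤n)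
  (labelsOfColumns-cong (C ∘ suc) (D ∘ suc) r (λ k k≤r → C≗D (suc k) (s≤s k≤r)))

countN-replicate : ∀ a ρ → countN (replicate a N ++ ρ) ≡ a ℕ.+ countN ρ
countN-replicate zero    ρ = refl
countN-replicate (suc a) ρ = cong suc (countN-replicate a ρ)

countE-replicate : ∀ a ρ → countE (replicate a N ++ ρ) ≡ countE ρ
countE-replicate zero    ρ = refl
countE-replicate (suc a) ρ = countE-replicate a ρ

countN-pathOfColumns : ∀ C r → countN (pathOfColumns C r) ≡ length (labelsOfColumns C r)
countN-pathOfColumns C zero    = begin
  countN (replicate (length (C 0)) N)        ≡⟨ cong countN (LP.++-identityʳ (replicate (length (C 0)) N)) ⟨
  countN (replicate (length (C 0)) N ++ [])  ≡⟨ countN-replicate (length (C 0)) [] ⟩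
  length (C 0) ℕ.+ 0                         ≡⟨ ℕP.+-identityʳ _ ⟩
  length (C 0)                               ∎
  where open ≡-Reasoning
countN-pathOfColumns C (suc r) = begin
  countN (replicate (length (C 0)) N ++ E ∷ pathOfColumns (C ∘ suc) r)
    ≡⟨ countN-replicate (length (C 0)) _ ⟩
  length (C 0) ℕ.+ countN (pathOfColumns (C ∘ suc) r)
    ≡⟨ cong (length (C 0) ℕ.+_) (countN-pathOfColumns (C ∘ suc) r) ⟩
  length (C 0) ℕ.+ length (labelsOfColumns (C ∘ suc) r)
    ≡⟨ LP.length-++ (C 0) ⟨
  length (labelsOfColumns C (suc r))
    ∎
  where open ≡-Reasoning

countE-pathOfColumns : ∀ C r → countE (pathOfColumns C r) ≡ r
countE-pathOfColumns C zero    =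
  trans (cong countE (sym (LP.++-identityʳ (replicate (length (C 0)) N)))) (countE-replicate (length (C 0)) [])
countE-pathOfColumns C (suc r) =
  trans (countE-replicate (length (C 0)) _) (cong suc (countE-pathOfColumns (C ∘ suc) r))

labelsOfColumns-↭ : ∀ C D r → (∀ k → C k ↭ D k) → labelsOfColumns C r ↭ labelsOfColumns D r
labelsOfColumns-↭ C D zero    C↭D = C↭D 0
labelsOfColumns-↭ C D (suc r) C↭D =
  PermP.++⁺ (C↭D 0) (labelsOfColumns-↭ (C ∘ suc) (D ∘ suc) r (C↭D ∘ suc))

labelsOfColumns-++ : ∀ C D r → labelsOfColumns (λ k → C k ++ D k) r ↭ labelsOfColumns C r ++ labelsOfColumns D r
labelsOfColumns-++ C D zero    = ↭-refl
labelsOfColumns-++ C D (suc r) = begin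
  (C 0 ++ D 0) ++ labelsOfColumns (λ k → C (suc k) ++ D (suc k)) r
    ↭⟨ PermP.++⁺ˡ (C 0 ++ D 0) (labelsOfColumns-++ (C ∘ suc) (D ∘ suc) r) ⟩
  (C 0 ++ D 0) ++ labelsOfColumns (C ∘ suc) r ++ labelsOfColumns (D ∘ suc) r
    ≡⟨ LP.++-assoc (C 0) (D 0) _ ⟩
  C 0 ++ D 0 ++ labelsOfColumns (C ∘ suc) r ++ labelsOfColumns (D ∘ suc) r
    ↭⟨ PermP.++⁺ˡ (C 0) (PermP.shifts (D 0) (labelsOfColumns (C ∘ suc) r)) ⟩
  C 0 ++ labelsOfColumns (C ∘ suc) r ++ D 0 ++ labelsOfColumns (D ∘ suc) r
    ≡⟨ LP.++-assoc (C 0) _ _ ⟨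
  (C 0 ++ labelsOfColumns (C ∘ suc) r) ++ D 0 ++ labelsOfColumns (D ∘ suc) r
    ∎
  where open PermutationReasoning

labelsOfColumns-[] : ∀ C r → (∀ k → C k ≡ []) → labelsOfColumns C r ≡ []
labelsOfColumns-[] C zero    C≡[] = C≡[] 0
labelsOfColumns-[] C (suc r) C≡[] = cong₂ _++_ (C≡[] 0) (labelsOfColumns-[] (C ∘ suc) r (C≡[] ∘ suc))

labelsOfColumns-single : ∀ C {b} c r → c ≤ r → C c ≡ b ∷ [] → (∀ k → k ≢ c → C k ≡ []) →
  labelsOfColumns C r ≡ b ∷ []
labelsOfColumns-single C zero    zero    _         Cc≡b _   = Cc≡b
labelsOfColumns-single C zero    (suc r) _         Cc≡b off =
  cong₂ _++_ Cc≡b (labelsOfColumns-[] (C ∘ suc) r (λ k → off (suc k) (λ ())))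
labelsOfColumns-single C (suc c) (suc r) (s≤s c≤r) Cc≡b off =
  cong₂ _++_ (off 0 (λ ()))
    (labelsOfColumns-single (C ∘ suc) c r c≤r Cc≡b (λ k k≢c → off (suc k) (k≢c ∘ ℕP.suc-injective)))

labelsOfColumns-mapMaybe-↭ : ∀ {A : Set} (select : ℕ → A → Maybe ℤ) (lab : A → ℤ) (colOf : A → ℕ) →
  (∀ a → select (colOf a) a ≡ just (lab a)) → (∀ a k → k ≢ colOf a → select k a ≡ nothing) →
  ∀ r xs → All (λ a → colOf a ≤ r) xs → labelsOfColumns (λ k → mapMaybe (select k) xs) r ↭ map lab xs
labelsOfColumns-mapMaybe-↭ select lab colOf hit miss r []       _            =
  ↭-reflexive (labelsOfColumns-[] _ r (λ _ → refl))
labelsOfColumns-mapMaybe-↭ select lab colOf hit miss r (a ∷ xs) (a≤r ∷ xs≤r) = begin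
  labelsOfColumns (λ k → mapMaybe (select k) (a ∷ xs)) r
    ≡⟨ labelsOfColumns-cong _ _ r (λ k _ → mapMaybe-∷ (select k) a xs) ⟩
  labelsOfColumns (λ k → fromMaybe (select k a) ++ mapMaybe (select k) xs) r
    ↭⟨ labelsOfColumns-++ (λ k → fromMaybe (select k a)) _ r ⟩
  labelsOfColumns (λ k → fromMaybe (select k a)) r ++ labelsOfColumns (λ k → mapMaybe (select k) xs) r
    ≡⟨ cong (_++ _) (labelsOfColumns-single _ (colOf a) r a≤r
         (cong fromMaybe (hit a)) (λ k k≢ → cong fromMaybe (miss a k k≢))) ⟩
  lab a ∷ labelsOfColumns (λ k → mapMaybe (select k) xs) r
    <⟨ labelsOfColumns-mapMaybe-↭ select lab colOf hit miss r xs xs≤r ⟩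
  lab a ∷ map lab xs
    ∎
  where open PermutationReasoning

Ψ-columns : ∀ n (f : Vec ℤ n) → Ψ n f ≡ (pathOfColumns (L f) n , labelsOfColumns (L f) n)
Ψ-columns n f = cong₂ _,_ (path-blocks id n (λ _ j<n → j<n) (ℕP.<-irrefl refl)) (labels-blocks id n)
  where
  block : ℕ → List Step
  block k = replicate (length (L f k)) N ++ (if ⌊ k ℕ.<? n ⌋ then E ∷ [] else [])

  path-blocks : ∀ (h : ℕ → ℕ) r → (∀ j → j < r → h j < n) → ¬ (h r < n) →
    L.concatMap block (L.applyUpTo h (suc r)) ≡ pathOfColumns (L f ∘ h) r
  path-blocks h zero    _    hr≮n with h 0 ℕ.<? n
  ... | yes h0<n = ⊥-elim (hr≮n h0<n)
  ... | no  _    = trans (LP.++-identityʳ _) (LP.++-identityʳ _)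
  path-blocks h (suc r) hj<n hr≮n with h 0 ℕ.<? n
  ... | no  h0≮n = ⊥-elim (h0≮n (hj<n 0 (s≤s z≤n)))
  ... | yes _    = trans (LP.++-assoc (replicate (length (L f (h 0))) N) (E ∷ []) _)
    (cong (λ ρ → replicate (length (L f (h 0))) N ++ E ∷ ρ)
      (path-blocks (h ∘ suc) r (λ j j<r → hj<n (suc j) (s≤s j<r)) hr≮n))

  labels-blocks : ∀ (h : ℕ → ℕ) r → L.concatMap (L f) (L.applyUpTo h (suc r)) ≡ labelsOfColumns (L f ∘ h) r
  labels-blocks h zero    = LP.++-identityʳ _
  labels-blocks h (suc r) = cong (L f (h 0) ++_) (labels-blocks (h ∘ suc) r)

-- Rises

mutual
  IncreasingOnRises : List Step → List ℤ → Set
  IncreasingOnRises []      σ       = ⊤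
  IncreasingOnRises (E ∷ π) σ       = IncreasingOnRises π σ
  IncreasingOnRises (N ∷ π) []      = ⊤
  IncreasingOnRises (N ∷ π) (x ∷ σ) = IncreasingOnRisesAfter x π σ

  -- π and σ continue a path whose last step is a North step labelled x.
  IncreasingOnRisesAfter : ℤ → List Step → List ℤ → Set
  IncreasingOnRisesAfter x []      σ       = ⊤
  IncreasingOnRisesAfter x (E ∷ π) σ       = IncreasingOnRises π σ
  IncreasingOnRisesAfter x (N ∷ π) []      = ⊤
  IncreasingOnRisesAfter x (N ∷ π) (y ∷ σ) = x ℤ.< y × IncreasingOnRisesAfter y π σ

IncreasingOnRisesAfter⇒IncreasingOnRises : ∀ x π σ → IncreasingOnRisesAfter x π σ → IncreasingOnRises π σ
IncreasingOnRisesAfter⇒IncreasingOnRises x []      σ       _       = tt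
IncreasingOnRisesAfter⇒IncreasingOnRises x (E ∷ π) σ       inc     = inc
IncreasingOnRisesAfter⇒IncreasingOnRises x (N ∷ π) []      _       = tt
IncreasingOnRisesAfter⇒IncreasingOnRises x (N ∷ π) (y ∷ σ) (_ , inc) = inc

RiseCondition : List Step → List ℤ → Set
RiseCondition π σ = ∀ (i j : Fin (length σ)) → toℕ j ≡ suc (toℕ i) →
  IsRise π (suc (toℕ i)) → L.lookup σ i ℤ.< L.lookup σ j

IncreasingOnRises⇒RiseCondition : ∀ π σ → IncreasingOnRises π σ → RiseCondition π σ
IncreasingOnRises⇒RiseCondition π σ inc i j j≡1+i (p , q , refl , p≡i) = go p q σ inc i j j≡1+i p≡i
  where
  go : ∀ p q σ → IncreasingOnRises (p ++ N ∷ N ∷ q) σ →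
    ∀ (i j : Fin (length σ)) → toℕ j ≡ suc (toℕ i) →
    suc (countN p) ≡ suc (toℕ i) → L.lookup σ i ℤ.< L.lookup σ j
  go []      q (x ∷ y ∷ σ) (x<y , _) F.zero    (F.suc F.zero) _ _ = x<y
  go []      q (x ∷ y ∷ σ) _         F.zero    (F.suc (F.suc j)) () _
  go []      q (x ∷ [])    _         F.zero    (F.suc ()) _ _
  go []      q (x ∷ σ)     _         (F.suc i) j _ ()
  go (E ∷ p) q σ           inc       i         j e c = go p q σ inc i j e c
  go (N ∷ p) q (x ∷ σ)     inc       (F.suc i) (F.suc j) e c =
    go p q σ (IncreasingOnRisesAfter⇒IncreasingOnRises x (p ++ N ∷ N ∷ q) σ inc) i j
      (ℕP.suc-injective e) (ℕP.suc-injective c)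

RiseCondition-N∷ : ∀ π x σ → RiseCondition (N ∷ π) (x ∷ σ) → RiseCondition π σ
RiseCondition-N∷ π x σ rises i j e (p , q , π≡ , c) =
  rises (F.suc i) (F.suc j) (cong suc e) (N ∷ p , q , cong (N ∷_) π≡ , cong suc c)

RiseCondition-E∷ : ∀ π σ → RiseCondition (E ∷ π) σ → RiseCondition π σ
RiseCondition-E∷ π σ rises i j e (p , q , π≡ , c) = rises i j e (E ∷ p , q , cong (E ∷_) π≡ , c)

mutual
  RiseCondition⇒IncreasingOnRises : ∀ π σ → RiseCondition π σ → IncreasingOnRises π σ
  RiseCondition⇒IncreasingOnRises []      σ       _     = tt
  RiseCondition⇒IncreasingOnRises (E ∷ π) σ       rises =
    RiseCondition⇒IncreasingOnRises π σ (RiseCondition-E∷ π σ rises)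
  RiseCondition⇒IncreasingOnRises (N ∷ π) []      _     = tt
  RiseCondition⇒IncreasingOnRises (N ∷ π) (x ∷ σ) rises = RiseCondition⇒IncreasingOnRisesAfter x π σ rises

  RiseCondition⇒IncreasingOnRisesAfter : ∀ x π σ → RiseCondition (N ∷ π) (x ∷ σ) →
    IncreasingOnRisesAfter x π σ
  RiseCondition⇒IncreasingOnRisesAfter x []      σ       _     = tt
  RiseCondition⇒IncreasingOnRisesAfter x (E ∷ π) σ       rises =
    RiseCondition⇒IncreasingOnRises π σ (RiseCondition-E∷ π σ (RiseCondition-N∷ (E ∷ π) x σ rises))
  RiseCondition⇒IncreasingOnRisesAfter x (N ∷ π) []      _     = tt
  RiseCondition⇒IncreasingOnRisesAfter x (N ∷ π) (y ∷ σ) rises =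
    rises F.zero (F.suc F.zero) refl ([] , π , refl , refl) ,
    RiseCondition⇒IncreasingOnRisesAfter y π σ (RiseCondition-N∷ (N ∷ π) x (y ∷ σ) rises)

-- What may follow a column: the end of the path or an East step.
ClosesColumn : List Step → Set
ClosesColumn (N ∷ _) = ⊥
ClosesColumn _       = ⊤

block-IncreasingOnRisesAfter : ∀ x c ρ σ → Linked ℤ._<_ (x ∷ c) →
  IncreasingOnRises ρ σ → ClosesColumn ρ →
  IncreasingOnRisesAfter x (replicate (length c) N ++ ρ) (c ++ σ)
block-IncreasingOnRisesAfter x []      []      σ _           _   _ = tt
block-IncreasingOnRisesAfter x []      (E ∷ ρ) σ _           inc _ = inc
block-IncreasingOnRisesAfter x (y ∷ c) ρ       σ (x<y ∷ c↗) inc ρ-closes =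
  x<y , block-IncreasingOnRisesAfter y c ρ σ c↗ inc ρ-closes

block-IncreasingOnRises : ∀ c ρ σ → Linked ℤ._<_ c → IncreasingOnRises ρ σ → ClosesColumn ρ →
  IncreasingOnRises (replicate (length c) N ++ ρ) (c ++ σ)
block-IncreasingOnRises []      ρ σ _  inc _        = inc
block-IncreasingOnRises (x ∷ c) ρ σ c↗ inc ρ-closes = block-IncreasingOnRisesAfter x c ρ σ c↗ inc ρ-closes

pathOfColumns-IncreasingOnRises : ∀ C r → (∀ k → k ≤ r → Linked ℤ._<_ (C k)) →
  IncreasingOnRises (pathOfColumns C r) (labelsOfColumns C r)
pathOfColumns-IncreasingOnRises C zero    C↗ =
  subst₂ IncreasingOnRises (LP.++-identityʳ (replicate (length (C 0)) N)) (LP.++-identityʳ (C 0))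
    (block-IncreasingOnRises (C 0) [] [] (C↗ 0 z≤n) tt tt)
pathOfColumns-IncreasingOnRises C (suc r) C↗ =
  block-IncreasingOnRises (C 0) _ _ (C↗ 0 z≤n)
    (pathOfColumns-IncreasingOnRises (C ∘ suc) r (λ k k≤r → C↗ (suc k) (s≤s k≤r))) tt

pathOfColumns-FirstCond : ∀ C r → All (+ 0 ℤ.<_) (C 0) →
  FirstCond (pathOfColumns C (suc r)) (labelsOfColumns C (suc r))
pathOfColumns-FirstCond C r C₀>0 with C 0
... | []    = tt
pathOfColumns-FirstCond C r (x>0 ∷ _) | x ∷ _ = x>0

column₀-after-increasing : ∀ x π σ → IncreasingOnRisesAfter x π σ → Linked ℤ._<_ (x ∷ column π σ 0)
column₀-after-increasing x []      σ       _           = [-]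
column₀-after-increasing x (E ∷ π) σ       _           = [-]
column₀-after-increasing x (N ∷ π) []      _           = [-]
column₀-after-increasing x (N ∷ π) (y ∷ σ) (x<y , inc) = x<y ∷ column₀-after-increasing y π σ inc

column-increasing : ∀ π σ → IncreasingOnRises π σ → ∀ k → Linked ℤ._<_ (column π σ k)
column-increasing []      σ       _   k       = []
column-increasing (E ∷ π) σ       inc zero    = []
column-increasing (E ∷ π) σ       inc (suc k) = column-increasing π σ inc k
column-increasing (N ∷ π) []      _   k       = []
column-increasing (N ∷ π) (x ∷ σ) inc zero    = column₀-after-increasing x π σ inc
column-increasing (N ∷ π) (x ∷ σ) inc (suc k) =
  column-increasing π σ (IncreasingOnRisesAfter⇒IncreasingOnRises x π σ inc) (suc k)

column₀-positive : ∀ π σ → IncreasingOnRises π σ → FirstCond π σ → All (+ 0 ℤ.<_) (column π σ 0)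
column₀-positive []      σ       _   _   = []
column₀-positive (E ∷ π) σ       _   _   = []
column₀-positive (N ∷ π) []      _   _   = []
column₀-positive (N ∷ π) (x ∷ σ) inc x>0 =
  Linked⇒All ℤP.<-trans x>0 (column₀-after-increasing x π σ inc)

∈-column⇒∈-zip : ∀ π σ {z k} → z ∈ column π σ k → (z , k) ∈ zip σ (northXs π 0)
∈-column⇒∈-zip π σ = go π σ 0 refl
  where
  go : ∀ π σ x {j k z} → x ℕ.+ j ≡ k → z ∈ column π σ j → (z , k) ∈ zip σ (northXs π x)
  go (N ∷ π) (y ∷ σ) x {zero}  x+0≡k (here refl) = here (cong (y ,_) (trans (sym x+0≡k) (ℕP.+-identityʳ x)))
  go (N ∷ π) (y ∷ σ) x {zero}  x+0≡k (there z∈)  = there (go π σ x x+0≡k z∈)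
  go (N ∷ π) (y ∷ σ) x {suc j} x+j≡k z∈          = there (go π σ x x+j≡k z∈)
  go (E ∷ π) σ       x {suc j} x+j≡k z∈          = go π σ (suc x) (trans (sym (ℕP.+-suc x j)) x+j≡k) z∈

∈-zip⇒∈-column : ∀ π σ {z k} → (z , k) ∈ zip σ (northXs π 0) → z ∈ column π σ k
∈-zip⇒∈-column π σ {z} zk∈ =
  let j , k≡j , z∈ = go π σ 0 zk∈ in subst (λ k → z ∈ column π σ k) (sym k≡j) z∈
  where
  go : ∀ π σ x {k z} → (z , k) ∈ zip σ (northXs π x) → ∃[ j ] k ≡ x ℕ.+ j × z ∈ column π σ j
  go (N ∷ π) (y ∷ σ) x (here refl) = 0 , sym (ℕP.+-identityʳ x) , here refl
  go (N ∷ π) (y ∷ σ) x (there zk∈) with go π σ x zk∈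
  ... | zero  , k≡x+j , z∈ = zero  , k≡x+j , there z∈
  ... | suc j , k≡x+j , z∈ = suc j , k≡x+j , z∈
  go (E ∷ π) σ       x zk∈ with go π σ (suc x) zk∈
  ... | j , k≡x+j , z∈ = suc j , trans k≡x+j (sym (ℕP.+-suc x j)) , z∈

length-northXs : ∀ π x → length (northXs π x) ≡ countN π
length-northXs []      x = refl
length-northXs (N ∷ π) x = cong suc (length-northXs π x)
length-northXs (E ∷ π) x = length-northXs π (suc x)

northXs-bounded : ∀ π x → All (ℕ._≤ x ℕ.+ countE π) (northXs π x)
northXs-bounded []      x = []
northXs-bounded (N ∷ π) x = ℕP.m≤m+n x (countE π) ∷ northXs-bounded π x
northXs-bounded (E ∷ π) x =
  subst (λ b → All (ℕ._≤ b) (northXs π (suc x))) (sym (ℕP.+-suc x (countE π))) (northXs-bounded π (suc x))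

-- Signed labels and the sets L_k

-- sgn(ℓ)·c, with 0 counted as positive.
withSignOf : ℤ → ℕ → ℤ
withSignOf (+ _)    c = + c
withSignOf -[1+ _ ] c = - (+ c)

∣withSignOf∣ : ∀ ℓ c → ∣ withSignOf ℓ c ∣ ≡ c
∣withSignOf∣ (+ _)    c       = refl
∣withSignOf∣ -[1+ _ ] zero    = refl
∣withSignOf∣ -[1+ _ ] (suc c) = refl

withSignOf-withSignOf : ∀ v m → withSignOf (withSignOf v (suc m)) ∣ v ∣ ≡ v
withSignOf-withSignOf (+ _)    m = refl
withSignOf-withSignOf -[1+ _ ] m = refl

∣∣≡suc : ∀ z → z ≢ + 0 → ∃[ m ] ∣ z ∣ ≡ suc m
∣∣≡suc (+ zero)  z≢0 = ⊥-elim (z≢0 refl)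
∣∣≡suc (+ suc m) _   = m , refl
∣∣≡suc -[1+ m ]  _   = m , refl

∣∣≤⇒bounded : ∀ v n → ∣ v ∣ ≤ n → - (+ n) ℤ.≤ v × v ℤ.≤ + n
∣∣≤⇒bounded (+ _)    n       v≤n       = ℤP.neg-≤-pos , ℤ.+≤+ v≤n
∣∣≤⇒bounded -[1+ _ ] (suc n) (s≤s v≤n) = ℤ.-≤- v≤n , ℤ.-≤+

bounded⇒∣∣≤ : ∀ v n → - (+ n) ℤ.≤ v → v ℤ.≤ + n → ∣ v ∣ ≤ n
bounded⇒∣∣≤ (+ _)    n       _           (ℤ.+≤+ v≤n) = v≤n
bounded⇒∣∣≤ -[1+ _ ] (suc n) (ℤ.-≤- v≤n) _           = s≤s v≤n

label : ∀ {n} → Vec ℤ n → Fin n → ℤ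
label f i = withSignOf (V.lookup f i) (suc (toℕ i))

gval-∈ : ∀ m σ (xs : List ℕ) {ℓ c} → Unique (map ∣_∣ σ) →
  (ℓ , c) ∈ zip σ xs → ∣ ℓ ∣ ≡ suc m →
  gval m (zip σ xs) ≡ withSignOf ℓ c
gval-∈ m (+ a ∷ σ) (x ∷ xs) (_ ∷ _) (here refl) refl with + a ℤ.≟ + a
... | yes _   = refl
... | no a≢a  = ⊥-elim (a≢a refl)
gval-∈ m (-[1+ a ] ∷ σ) (x ∷ xs) (_ ∷ _) (here refl) refl
  with -[1+ a ] ℤ.≟ + suc a | -[1+ a ] ℤ.≟ -[1+ a ]
... | no _ | yes _  = refl
... | no _ | no a≢a = ⊥-elim (a≢a refl)
gval-∈ m (y ∷ σ) (x ∷ xs) (y∉ ∷ σ!) (there ℓc∈) ∣ℓ∣≡ with y ℤ.≟ + suc m | y ℤ.≟ -[1+ m ]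
... | yes refl | _        = ⊥-elim (All.lookup y∉ ∣ℓ∣∈ (sym ∣ℓ∣≡))
  where ∣ℓ∣∈ = MP.∈-map⁺ ∣_∣ (∈-zip⇒∈ˡ σ xs ℓc∈)
... | no _     | yes refl = ⊥-elim (All.lookup y∉ ∣ℓ∣∈ (sym ∣ℓ∣≡))
  where ∣ℓ∣∈ = MP.∈-map⁺ ∣_∣ (∈-zip⇒∈ˡ σ xs ℓc∈)
... | no _     | no _     = gval-∈ m σ xs σ! ℓc∈ ∣ℓ∣≡

∣gval∣≤ : ∀ m n (Z : List (ℤ × ℕ)) → All ((ℕ._≤ n) ∘ proj₂) Z → ∣ gval m Z ∣ ≤ n
∣gval∣≤ m n []             _          = z≤n
∣gval∣≤ m n ((ℓ , j) ∷ Z) (j≤n ∷ Z≤n) with ℓ ℤ.≟ + suc m | ℓ ℤ.≟ -[1+ m ]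
... | yes _ | _     = j≤n
... | no _  | yes _ = subst (_≤ n) (sym (ℤP.∣-i∣≡∣i∣ (+ j))) j≤n
... | no _  | no _  = ∣gval∣≤ m n Z Z≤n

-- pick f k i reduces to pickValue (lookup f i) k (toℕ i).
pickValue : ℤ → ℕ → ℕ → Maybe ℤ
pickValue v k m =
  if ⌊ v ℤ.≟ + k ⌋ then just (+ suc m)
  else (if ⌊ 0 ℕ.<? k ⌋ then
          (if ⌊ v ℤ.≟ - (+ k) ⌋ then just (-[1+ m ]) else nothing)
        else nothing)

pickValue-∣∣ : ∀ v m → pickValue v ∣ v ∣ m ≡ just (withSignOf v (suc m))
pickValue-∣∣ (+ a) m with + a ℤ.≟ + a
... | yes _  = refl
... | no a≢a = ⊥-elim (a≢a refl)
pickValue-∣∣ -[1+ a ] m with -[1+ a ] ℤ.≟ + suc a | 0 ℕ.<? suc a | -[1+ a ] ℤ.≟ -[1+ a ]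
... | no _ | yes _   | yes _  = refl
... | no _ | no 0≮1+a | _     = ⊥-elim (0≮1+a (s≤s z≤n))
... | no _ | yes _   | no a≢a = ⊥-elim (a≢a refl)

pickValue-≢ : ∀ v k m → k ≢ ∣ v ∣ → pickValue v k m ≡ nothing
pickValue-≢ (+ a) k m k≢a with + a ℤ.≟ + k
... | yes a≡k = ⊥-elim (k≢a (sym (ℤP.+-injective a≡k)))
... | no _ with 0 ℕ.<? k
...   | no _ = refl
pickValue-≢ (+ a) (suc k) m k≢a | no _ | yes _ with + a ℤ.≟ -[1+ k ]
...     | no _ = refl
pickValue-≢ -[1+ a ] k m k≢a with -[1+ a ] ℤ.≟ + k
... | no _ with 0 ℕ.<? k
...   | no _ = refl
pickValue-≢ -[1+ a ] (suc k) m k≢a | no _ | yes _ with -[1+ a ] ℤ.≟ -[1+ k ]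
...     | yes a≡k = ⊥-elim (k≢a (cong suc (sym (ℤP.-[1+-injective a≡k))))
...     | no _    = refl

pickValue-just⁻ : ∀ v k m {z} → pickValue v k m ≡ just z → k ≡ ∣ v ∣ × z ≡ withSignOf v (suc m)
pickValue-just⁻ v k m picked with k ℕ.≟ ∣ v ∣
... | yes refl = refl , MaybeP.just-injective (trans (sym picked) (pickValue-∣∣ v m))
... | no k≢∣v∣ with trans (sym picked) (pickValue-≢ v k m k≢∣v∣)
...   | ()

pickValue-functional : ∀ v k c m {z ℓ} → pickValue v k m ≡ just z → pickValue v c m ≡ just ℓ →
  k ≡ c × z ≡ ℓ
pickValue-functional v k c m pz pℓ with pickValue-just⁻ v k m pz | pickValue-just⁻ v c m pℓ
... | refl , refl | refl , refl = refl , refl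

-- Column 0 cannot hold a negative label, since −0 = +0.
pickValue-withSignOf : ∀ z k m → ∣ z ∣ ≡ suc m → (k ≡ 0 → + 0 ℤ.< z) →
  pickValue (withSignOf z k) k m ≡ just z
pickValue-withSignOf (+ _)    k       m refl _   = pickValue-∣∣ (+ k) m
pickValue-withSignOf -[1+ _ ] zero    m _    z>0 with z>0 refl
... | ()
pickValue-withSignOf -[1+ _ ] (suc k) m refl _   = pickValue-∣∣ -[1+ k ] m

Lᵘ : ∀ {n} → Vec ℤ n → ℕ → List ℤ
Lᵘ {n} f k = mapMaybe (pick f k) (allFin n)

∈-L⁺ : ∀ {n} (f : Vec ℤ n) k {z} → z ∈ Lᵘ f k → z ∈ L f k
∈-L⁺ f k = PermP.∈-resp-↭ (↭-sym (sort-↭ (Lᵘ f k)))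

∈-L⁻ : ∀ {n} (f : Vec ℤ n) k {z} → z ∈ L f k → z ∈ Lᵘ f k
∈-L⁻ f k = PermP.∈-resp-↭ (sort-↭ (Lᵘ f k))

Unique-suc-toℕ-allFin : ∀ n → Unique (map (suc ∘ toℕ) (allFin n))
Unique-suc-toℕ-allFin n = UniqueP.map⁺ (FP.toℕ-injective ∘ ℕP.suc-injective) (UniqueP.allFin⁺ n)

Unique-∣L∣ : ∀ {n} (f : Vec ℤ n) k → Unique (map ∣_∣ (L f k))
Unique-∣L∣ {n} f k = Unique-resp-↭ (PermP.map⁺ ∣_∣ (↭-sym (sort-↭ (Lᵘ f k))))
  (Unique-map-mapMaybe (pick f k) (suc ∘ toℕ) ∣_∣ ∣picked∣ (allFin n) (Unique-suc-toℕ-allFin n))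
  where
  ∣picked∣ : ∀ {i z} → pick f k i ≡ just z → ∣ z ∣ ≡ suc (toℕ i)
  ∣picked∣ {i} picked =
    trans (cong ∣_∣ (proj₂ (pickValue-just⁻ (V.lookup f i) k (toℕ i) picked)))
          (∣withSignOf∣ (V.lookup f i) _)

L-increasing : ∀ {n} (f : Vec ℤ n) k → Linked ℤ._<_ (L f k)
L-increasing f k = nondecreasing∧Unique-∣∣⇒increasing (sort-↗ (Lᵘ f k)) (Unique-∣L∣ f k)

-- The bijection

module ForwardMap {n : ℕ} (f : Vec ℤ n) (isCPF : IsTypeCPF n f) where

  π : List Step
  π = pathOfColumns (L f) n

  σ : List ℤ
  σ = labelsOfColumns (L f) n

  ∣f∣≤n : All (λ i → ∣ V.lookup f i ∣ ≤ n) (allFin n)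
  ∣f∣≤n = All.tabulate (λ {i} _ → bounded⇒∣∣≤ (V.lookup f i) n (proj₁ (isCPF i)) (proj₂ (isCPF i)))

  σ↭labels : σ ↭ map (label f) (allFin n)
  σ↭labels = begin
    labelsOfColumns (L f) n   ↭⟨ labelsOfColumns-↭ (L f) (Lᵘ f) n (sort-↭ ∘ Lᵘ f) ⟩
    labelsOfColumns (Lᵘ f) n  ↭⟨ labelsOfColumns-mapMaybe-↭ (pick f) (label f) (∣_∣ ∘ V.lookup f)
                                  (λ i → pickValue-∣∣ (V.lookup f i) (toℕ i))
                                  (λ i k k≢ → pickValue-≢ (V.lookup f i) k (toℕ i) k≢)
                                  n (allFin n) ∣f∣≤n ⟩
    map (label f) (allFin n)  ∎
    where open PermutationReasoning

  length≡n : length σ ≡ n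
  length≡n = trans (PermP.↭-length σ↭labels) (trans (LP.length-map (label f) (allFin n)) (LP.length-tabulate id))

  ∣label∣ : ∀ i → ∣ label f i ∣ ≡ suc (toℕ i)
  ∣label∣ i = ∣withSignOf∣ (V.lookup f i) _

  Unique-∣σ∣ : Unique (map ∣_∣ σ)
  Unique-∣σ∣ = Unique-resp-↭ (PermP.map⁺ ∣_∣ (↭-sym σ↭labels))
    (subst Unique (trans (LP.map-cong (sym ∘ ∣label∣) (allFin n)) (LP.map-∘ (allFin n)))
      (Unique-suc-toℕ-allFin n))

  ∈σ⇒label : ∀ {z} → z ∈ σ → ∃[ i ] z ≡ label f i
  ∈σ⇒label z∈ with MP.∈-map⁻ (label f) (PermP.∈-resp-↭ σ↭labels z∈)
  ... | i , _ , z≡ = i , z≡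

  label∈σ : ∀ i → label f i ∈ σ
  label∈σ i = PermP.∈-resp-↭ (↭-sym σ↭labels) (MP.∈-map⁺ (label f) (MP.∈-allFin i))

  isSignedPerm : IsSignedPerm n σ
  isSignedPerm = length≡n , nonzero , bounded , Unique-map⇒lookup-injective ∣_∣ σ Unique-∣σ∣ , surjective
    where
    ∣σ∣ : ∀ j → ∃[ i ] ∣ L.lookup σ j ∣ ≡ suc (toℕ i)
    ∣σ∣ j = let i , σj≡ = ∈σ⇒label (MP.∈-lookup j) in i , trans (cong ∣_∣ σj≡) (∣label∣ i)

    nonzero : ∀ j → ¬ (L.lookup σ j ≡ + 0)
    nonzero j σj≡0 with ∣σ∣ j
    ... | i , ∣σj∣≡ with trans (sym (cong ∣_∣ σj≡0)) ∣σj∣≡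
    ... | ()

    bounded : ∀ j → ∣ L.lookup σ j ∣ ≤ n
    bounded j = let i , ∣σj∣≡ = ∣σ∣ j in subst (_≤ n) (sym ∣σj∣≡) (FP.toℕ<n i)

    surjective : ∀ k → 1 ≤ k → k ≤ n → ∃[ j ] ∣ L.lookup σ j ∣ ≡ k
    surjective (suc k) _ k<n =
      let j , σj≡ = ∈⇒lookup (label∈σ (F.fromℕ< k<n))
      in j , trans (cong ∣_∣ σj≡) (trans (∣label∣ (F.fromℕ< k<n)) (cong suc (FP.toℕ-fromℕ< k<n)))

  L₀-positive : All (+ 0 ℤ.<_) (L f 0)
  L₀-positive = All.tabulate positive
    where
    positive : ∀ {z} → z ∈ L f 0 → + 0 ℤ.< z
    positive z∈ with ∈-mapMaybe⁻ (pick f 0) (allFin n) (∈-L⁻ f 0 z∈)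
    ... | i , _ , picked with V.lookup f i | pickValue-just⁻ (V.lookup f i) 0 (toℕ i) picked
    ... | + 0 | refl , refl = ℤ.+<+ (s≤s z≤n)

  firstCond : ∀ r → 1 ≤ r → FirstCond (pathOfColumns (L f) r) (labelsOfColumns (L f) r)
  firstCond (suc r) _ = pathOfColumns-FirstCond (L f) r L₀-positive

  isVLabelledPath : 1 ≤ n → IsVLabelledPath n (π , σ)
  isVLabelledPath 1≤n =
    (trans (countN-pathOfColumns (L f) n) length≡n , countE-pathOfColumns (L f) n) ,
    isSignedPerm ,
    IncreasingOnRises⇒RiseCondition π σ (pathOfColumns-IncreasingOnRises (L f) n (λ k _ → L-increasing f k)) ,
    firstCond n 1≤n

  Ψinv-Ψ : Ψinv n (Ψ n f) ≡ f
  Ψinv-Ψ = begin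
    Ψinv n (Ψ n f)                                         ≡⟨ cong (Ψinv n) (Ψ-columns n f) ⟩
    V.tabulate (λ i → gval (toℕ i) (zip σ (northXs π 0)))  ≡⟨ VP.tabulate-cong gval≡f ⟩
    V.tabulate (V.lookup f)                                ≡⟨ VP.tabulate∘lookup f ⟩
    f                                                      ∎
    where
    open ≡-Reasoning
    gval≡f : ∀ i → gval (toℕ i) (zip σ (northXs π 0)) ≡ V.lookup f i
    gval≡f i = trans (gval-∈ (toℕ i) σ (northXs π 0) Unique-∣σ∣ labelled (∣label∣ i))
                     (withSignOf-withSignOf (V.lookup f i) (toℕ i))
      where
      c = ∣ V.lookup f i ∣
      labelled : (label f i , c) ∈ zip σ (northXs π 0)
      labelled = ∈-column⇒∈-zip π σ
        (subst (label f i ∈_) (sym (column-pathOfColumns (L f) n c (All.lookup ∣f∣≤n (MP.∈-allFin i))))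
          (∈-L⁺ f c (∈-mapMaybe⁺ (pick f c) (MP.∈-allFin i) (pickValue-∣∣ (V.lookup f i) (toℕ i)))))

module InverseMap {n : ℕ} {π : List Step} {σ : List ℤ}
  (countN≡n : countN π ≡ n) (countE≡n : countE π ≡ n) (length≡n : length σ ≡ n)
  (nonzero : ∀ (j : Fin (length σ)) → ¬ (L.lookup σ j ≡ + 0))
  (bounded : ∀ (j : Fin (length σ)) → ∣ L.lookup σ j ∣ ≤ n)
  (injective : ∀ (i j : Fin (length σ)) → ∣ L.lookup σ i ∣ ≡ ∣ L.lookup σ j ∣ → i ≡ j)
  (surjective : ∀ k → 1 ≤ k → k ≤ n → ∃[ j ] ∣ L.lookup σ j ∣ ≡ k)
  (rises : RiseCondition π σ) (firstCond : FirstCond π σ)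
  where

  g : Vec ℤ n
  g = Ψinv n (π , σ)

  labelXs : List (ℤ × ℕ)
  labelXs = zip σ (northXs π 0)

  σ≤xs : length σ ≤ length (northXs π 0)
  σ≤xs = ℕP.≤-reflexive (trans length≡n (sym (trans (length-northXs π 0) countN≡n)))

  lookup-g : ∀ i → V.lookup g i ≡ gval (toℕ i) labelXs
  lookup-g = VP.lookup∘tabulate (λ i → gval (toℕ i) labelXs)

  increasing : IncreasingOnRises π σ
  increasing = RiseCondition⇒IncreasingOnRises π σ rises

  Unique-∣σ∣ : Unique (map ∣_∣ σ)
  Unique-∣σ∣ = lookup-injective⇒Unique-map ∣_∣ σ injective

  label-index : ∀ {z} → z ∈ σ → ∃[ i ] ∣ z ∣ ≡ suc (toℕ i)
  label-index z∈ with ∈⇒lookup z∈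
  ... | j , refl with ∣∣≡suc (L.lookup σ j) (nonzero j)
  ... | m , ∣σj∣≡ = F.fromℕ< m<n , trans ∣σj∣≡ (cong suc (sym (FP.toℕ-fromℕ< m<n)))
    where
    m<n : m < n
    m<n = subst (_≤ n) ∣σj∣≡ (bounded j)

  pick-g : ∀ {ℓ c} (i : Fin n) → (ℓ , c) ∈ labelXs → ∣ ℓ ∣ ≡ suc (toℕ i) → pick g c i ≡ just ℓ
  pick-g {ℓ} {c} i ℓc∈ ∣ℓ∣≡ = begin
    pickValue (V.lookup g i) c (toℕ i)
      ≡⟨ cong (λ v → pickValue v c (toℕ i)) g-at-i ⟩
    pickValue (withSignOf ℓ c) c (toℕ i)
      ≡⟨ pickValue-withSignOf ℓ c (toℕ i) ∣ℓ∣≡ column₀⇒positive ⟩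
    just ℓ
      ∎
    where
    open ≡-Reasoning
    g-at-i : V.lookup g i ≡ withSignOf ℓ c
    g-at-i = trans (lookup-g i) (gval-∈ (toℕ i) σ (northXs π 0) Unique-∣σ∣ ℓc∈ ∣ℓ∣≡)
    column₀⇒positive : c ≡ 0 → + 0 ℤ.< ℓ
    column₀⇒positive refl =
      All.lookup (column₀-positive π σ increasing firstCond) (∈-zip⇒∈-column π σ ℓc∈)

  column⊆L : ∀ k → column π σ k ⊆ L g k
  column⊆L k z∈ =
    let zk∈    = ∈-column⇒∈-zip π σ z∈
        i , ∣z∣≡ = label-index (∈-zip⇒∈ˡ σ (northXs π 0) zk∈)
    in ∈-L⁺ g k (∈-mapMaybe⁺ (pick g k) (MP.∈-allFin i) (pick-g i zk∈ ∣z∣≡))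

  L⊆column : ∀ k → L g k ⊆ column π σ k
  L⊆column k z∈ with ∈-mapMaybe⁻ (pick g k) (allFin n) (∈-L⁻ g k z∈)
  ... | i , _ , picked with surjective (suc (toℕ i)) (s≤s z≤n) (FP.toℕ<n i)
  ... | j , ∣σj∣≡ with ∈ˡ⇒∈-zip σ (northXs π 0) (MP.∈-lookup j) σ≤xs
  ... | c , σjc∈ with pickValue-functional (V.lookup g i) k c (toℕ i) picked (pick-g i σjc∈ ∣σj∣≡)
  ... | refl , refl = ∈-zip⇒∈-column π σ σjc∈

  L≡column : ∀ k → L g k ≡ column π σ k
  L≡column k = increasing-⊆-⊇⇒≡ (L-increasing g k) (column-increasing π σ increasing k)
    (L⊆column k) (column⊆L k)

  isTypeCPF : IsTypeCPF n g
  isTypeCPF i = subst (λ v → - (+ n) ℤ.≤ v × v ℤ.≤ + n) (sym (lookup-g i))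
    (∣∣≤⇒bounded _ n (∣gval∣≤ (toℕ i) n labelXs (All-zip-proj₂ σ xs≤n)))
    where
    xs≤n : All (_≤ n) (northXs π 0)
    xs≤n = subst (λ b → All (_≤ b) (northXs π 0)) countE≡n (northXs-bounded π 0)

  Ψ-Ψinv : Ψ n g ≡ (π , σ)
  Ψ-Ψinv = begin
    Ψ n g
      ≡⟨ Ψ-columns n g ⟩
    (pathOfColumns (L g) n , labelsOfColumns (L g) n)
      ≡⟨ cong₂ _,_ (pathOfColumns-cong _ _ n (λ k _ → L≡column k))
                   (labelsOfColumns-cong _ _ n (λ k _ → L≡column k)) ⟩
    (pathOfColumns (column π σ) n , labelsOfColumns (column π σ) n)
      ≡⟨ cong₂ _,_ (pathOfColumns-column π σ n countE≡n countN≡length)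
                   (labelsOfColumns-column π σ n countE≡n countN≡length) ⟩
    (π , σ)
      ∎
    where
    open ≡-Reasoning
    countN≡length : countN π ≡ length σ
    countN≡length = trans countN≡n (sym length≡n)

proposition3p3 : ∀ (n : ℕ) → 1 ≤ n →
    (∀ (f : Vec ℤ n) → IsTypeCPF n f → IsVLabelledPath n (Ψ n f))
    × (∀ (p : List Step × List ℤ) → IsVLabelledPath n p →
         IsTypeCPF n (Ψinv n p) × (Ψ n (Ψinv n p) ≡ p))
    × (∀ (f : Vec ℤ n) → IsTypeCPF n f → Ψinv n (Ψ n f) ≡ f)
proposition3p3 n 1≤n =
  (λ f isPF → subst (IsVLabelledPath n) (sym (Ψ-columns n f)) (ForwardMap.isVLabelledPath f isPF 1≤n)) ,
  (λ where
    (π , σ) ((cN , cE) , (len , nz , bd , inj , surj) , rises , first) →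
      let open InverseMap cN cE len nz bd inj surj rises first in isTypeCPF , Ψ-Ψinv) ,
  ForwardMap.Ψinv-Ψ
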